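{- Let $n\ge1$, $0\le k\le n$ and $U\subseteq\{1,\ldots,n\}$. If $n\notin U$ then \[b(n,k,U)=(k+1)\,b(n-1,k,U)+(n-k)\,b(n-1,k-1,U),\] and if $n\in U$ then, with $U'=U\setminus\{n\}$, \[b(n,k,U)=k\,b(n-1,k,U')+(n-k+1)\,b(n-1,k-1,U').\]
   Context: $\mathcal{B}_m$ is the set of signed permutations of order $m$: bijections $\sigma$ of $\{ -m,\ldots,m\}$ with $\sigma(-i)=-\sigma(i)$, identified with $(0,\sigma_1,\ldots,\sigma_m)$; $\mathrm{des}(\sigma)$ is the number of $i\in\{1,\ldots,m\}$ with $\sigma_{i-1}>\sigma_i$ ($\sigma_0=0$). For $U\subseteq\{1,\ldots,m\}$ and $0\le k\le m$, $b(m,k,U)$ is the number of $\sigma\in\mathcal{B}_m$ with $\mathrm{des}(\sigma)=k$ such that for every $1\le i\le m$, $\sigma_i<0$ iff $|\sigma_i|\in U$. Convention: $b(m,-1,U)=b(m,m+1,U)=0$. -}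

module Defs where

open import Data.Bool using (Bool; true; false; _∧_; not; if_then_else_)
open import Data.Nat using (ℕ; zero; suc; _+_; _∸_; _<ᵇ_; _≡ᵇ_)
open import Data.Integer using (ℤ; +_; -[1+_]; ∣_∣; _-_; _<?_)
import Data.Integer as ℤ
open import Data.List using (List; []; _∷_; map; concatMap; upTo; length; filterᵇ)
open import Data.Bool.ListAction using (all; any)
open import Data.Vec using (Vec; []; _∷_; toList; lookup)
open import Data.Fin using (Fin; zero; suc)
open import Data.Fin.Subset using (Subset)
open import Relation.Nullary.Decidable using (⌊_⌋)

-- Membership test  j ∈ U  for U ⊆ {1,…,m} encoded as  U : Subset m,
-- where position i (a Fin m) encodes the element i+1.
-- Returns false for j ∉ {1,…,m}.
memb : ∀ {m} → Subset m → ℕ → Bool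
memb []        _             = false
memb (b ∷ U)   zero          = false
memb (b ∷ U)   (suc zero)    = b
memb (b ∷ U)   (suc (suc j)) = memb U (suc j)

range : ℕ → List ℤ
range m = map (λ i → + i - + m) (upTo (suc (m + m)))

allVecs : List ℤ → (len : ℕ) → List (Vec ℤ len)
allVecs r zero    = [] ∷ []
allVecs r (suc l) = concatMap (λ x → map (x ∷_) (allVecs r l)) r

elemᵇ : ℕ → List ℕ → Bool
elemᵇ x xs = any (λ y → x ≡ᵇ y) xs

distinctᵇ : List ℕ → Bool
distinctᵇ []       = true
distinctᵇ (x ∷ xs) = not (elemᵇ x xs) ∧ distinctᵇ xs

-- (σ₁,…,σₘ) (with σ(-i) = -σ(i), σ(0)=0) is a signed permutation of order m
-- iff i ↦ |σᵢ| is a bijection of {1,…,m}, i.e. each |σᵢ| ∈ {1,…,m} and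
-- the |σᵢ| are pairwise distinct (m distinct values in an m-element set).
isSignedPerm : (m : ℕ) → Vec ℤ m → Bool
isSignedPerm m v =
  all (λ x → (0 <ᵇ ∣ x ∣) ∧ (∣ x ∣ <ᵇ suc m)) (toList v)
  ∧ distinctᵇ (map ∣_∣ (toList v))

signedPerms : (m : ℕ) → List (Vec ℤ m)
signedPerms m = filterᵇ (isSignedPerm m) (allVecs (range m) m)

desFrom : ℤ → List ℤ → ℕ
desFrom x []       = 0
desFrom x (y ∷ ys) = (if ⌊ y <? x ⌋ then 1 else 0) + desFrom y ys

des : ∀ {m} → Vec ℤ m → ℕ
des v = desFrom (+ 0) (toList v)

iffᵇ : Bool → Bool → Bool
iffᵇ true  c = c
iffᵇ false c = not c

signCond : ∀ {m} → Subset m → Vec ℤ m → Bool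
signCond U v = all (λ x → iffᵇ ⌊ x <? + 0 ⌋ (memb U ∣ x ∣)) (toList v)

-- b(m, k, U), with k an integer; for k < 0 (or k > m) no σ qualifies, so the
-- conventions b(m,-1,U) = b(m,m+1,U) = 0 hold by definition.
b : (m : ℕ) → ℤ → Subset m → ℕ
b m k U = length (filterᵇ (λ σ → ⌊ + des σ ℤ.≟ k ⌋ ∧ signCond U σ) (signedPerms m))

-- A signed permutation σ of order n with negative set U has exactly one entry of absolute value n:
-- it is n if n ∉ U and −n if n ∈ U. Deleting it leaves a signed permutation τ of order n − 1 with
-- negative set U ∖ {n}, and every such τ arises from n permutations σ, one per insertion position.
-- As the inserted entry is larger (resp. smaller) than all others, it adds a descent exactly when
-- it is put into the gap of an ascent of (0, τ₁, …, τₙ₋₁), or, for −n, at the end; elsewhere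
-- des σ = des τ. Since τ has n − 1 − des τ ascents, the positions giving des σ = des τ number
-- des τ + 1 for n and des τ for −n, and the rest give des σ = des τ + 1.
-- As b counts within all vectors over {−n, …, n}, the deletion is carried out as a double counting
-- of vectors weighted by their number of entries equal to ±n.

module Submission where

open import Defs
open import Data.Nat using (ℕ; suc; _+_; _*_; _∸_; _≤_)
open import Data.Integer using (+_; _-_)
open import Data.Bool using (true; false)
open import Data.Vec using (last; init)
open import Data.Fin.Subset using (Subset)
open import Data.Product using (_×_)
open import Relation.Binary.PropositionalEquality using (_≡_)

open import Data.Nat using (zero; z≤n; s≤s; s≤s⁻¹; _<ᵇ_; _≡ᵇ_)
open import Data.Nat.Properties hiding (_<?_; _≟_)
open import Algebra.Properties.CommutativeSemigroup +-commutativeSemigroup using (interchange; x∙yz≈y∙xz)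
open import Data.Bool using (Bool; not; _∧_; _∨_; T; if_then_else_)
open import Data.Bool.Properties using (∧-assoc; ∧-zeroʳ)
open import Data.Bool.Solver using (module ∨-∧-Solver)
open import Data.Bool.ListAction using (all)
open import Data.List using (List; []; _∷_; _++_; _∷ʳ_; map; concatMap; length; filterᵇ; applyUpTo)
open import Data.List.Properties using (length-map; map-applyUpTo; applyUpTo-∷ʳ)
open import Data.Vec using (Vec; []; _∷_; toList)
open import Data.Vec.Properties using (length-toList)
open import Data.Integer using (ℤ; -[1+_]; ∣_∣; _<?_)
import Data.Integer as ℤ
import Data.Integer.Properties as ℤ
open import Data.Product using (_,_; proj₁; proj₂)
open import Relation.Nullary.Decidable using (⌊_⌋; isYes≗does; dec-true; dec-false)
open import Relation.Binary.PropositionalEquality using (refl; sym; trans; cong; cong₂; subst; module ≡-Reasoning)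

-- Finite sums

𝟙 : Bool → ℕ
𝟙 b = if b then 1 else 0

∑ : {A : Set} → List A → (A → ℕ) → ℕ
∑ []       f = 0
∑ (x ∷ xs) f = f x + ∑ xs f

infix 5 ∑
syntax ∑ xs (λ x → e) = ∑[ x ∈ xs ] e

module _ {A : Set} where

  ∑-cong : ∀ xs {f g : A → ℕ} → (∀ x → f x ≡ g x) → ∑ xs f ≡ ∑ xs g
  ∑-cong []       eq = refl
  ∑-cong (x ∷ xs) eq = cong₂ _+_ (eq x) (∑-cong xs eq)

  ∑-zero : ∀ (xs : List A) → ∑[ x ∈ xs ] 0 ≡ 0
  ∑-zero []       = refl
  ∑-zero (_ ∷ xs) = ∑-zero xs

  ∑-+ : ∀ xs (f g : A → ℕ) → ∑[ x ∈ xs ] (f x + g x) ≡ ∑ xs f + ∑ xs g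
  ∑-+ []       f g = refl
  ∑-+ (x ∷ xs) f g rewrite ∑-+ xs f g = interchange (f x) (g x) (∑ xs f) (∑ xs g)

  ∑-*ˡ : ∀ xs c (f : A → ℕ) → ∑[ x ∈ xs ] (c * f x) ≡ c * ∑ xs f
  ∑-*ˡ []       c f = sym (*-zeroʳ c)
  ∑-*ˡ (x ∷ xs) c f rewrite ∑-*ˡ xs c f = sym (*-distribˡ-+ c (f x) (∑ xs f))

  ∑-++ : ∀ xs ys (f : A → ℕ) → ∑ (xs ++ ys) f ≡ ∑ xs f + ∑ ys f
  ∑-++ []       ys f = refl
  ∑-++ (x ∷ xs) ys f rewrite ∑-++ xs ys f = sym (+-assoc (f x) (∑ xs f) (∑ ys f))

  ∑-map : ∀ {B : Set} (h : B → A) xs (f : A → ℕ) → ∑ (map h xs) f ≡ ∑[ x ∈ xs ] f (h x)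
  ∑-map h []       f = refl
  ∑-map h (x ∷ xs) f = cong (_+_ (f (h x))) (∑-map h xs f)

  ∑-concatMap : ∀ {B : Set} (h : B → List A) xs (f : A → ℕ) →
                ∑ (concatMap h xs) f ≡ ∑[ x ∈ xs ] ∑ (h x) f
  ∑-concatMap h []       f = refl
  ∑-concatMap h (x ∷ xs) f =
    trans (∑-++ (h x) (concatMap h xs) f) (cong (_+_ (∑ (h x) f)) (∑-concatMap h xs f))

  ∑-filterᵇ : ∀ (p : A → Bool) xs (f : A → ℕ) →
              ∑ (filterᵇ p xs) f ≡ ∑[ x ∈ xs ] (𝟙 (p x) * f x)
  ∑-filterᵇ p []       f = refl
  ∑-filterᵇ p (x ∷ xs) f with p x
  ... | true  = cong₂ _+_ (sym (+-identityʳ (f x))) (∑-filterᵇ p xs f)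
  ... | false = ∑-filterᵇ p xs f

  length≡∑1 : ∀ (xs : List A) → length xs ≡ ∑[ x ∈ xs ] 1
  length≡∑1 []       = refl
  length≡∑1 (x ∷ xs) = cong suc (length≡∑1 xs)

∑< : ℕ → (ℕ → ℕ) → ℕ
∑< zero    f = 0
∑< (suc n) f = f 0 + ∑< n (λ i → f (suc i))

infix 5 ∑<
syntax ∑< n (λ i → e) = ∑[ i < n ] e

∑<-cong : ∀ n {f g : ℕ → ℕ} → (∀ i → f i ≡ g i) → ∑< n f ≡ ∑< n g
∑<-cong zero    eq = refl
∑<-cong (suc n) eq = cong₂ _+_ (eq 0) (∑<-cong n (λ i → eq (suc i)))

∑<-*ˡ : ∀ n c (f : ℕ → ℕ) → ∑[ i < n ] (c * f i) ≡ c * ∑< n f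
∑<-*ˡ zero    c f = sym (*-zeroʳ c)
∑<-*ˡ (suc n) c f rewrite ∑<-*ˡ n c (λ i → f (suc i)) = sym (*-distribˡ-+ c (f 0) _)

∑-∑<-comm : ∀ {A : Set} (xs : List A) n (f : A → ℕ → ℕ) →
            ∑[ x ∈ xs ] ∑[ i < n ] f x i ≡ ∑[ i < n ] ∑[ x ∈ xs ] f x i
∑-∑<-comm xs zero    f = ∑-zero xs
∑-∑<-comm xs (suc n) f =
  trans (∑-+ xs (λ x → f x 0) (λ x → ∑[ i < n ] f x (suc i)))
        (cong (_+_ (∑[ x ∈ xs ] f x 0)) (∑-∑<-comm xs n (λ x i → f x (suc i))))

∑<-select : ∀ n (δ : ℕ → Bool) a c →
  ∑[ i < n ] (if δ i then a else c) ≡ (∑[ i < n ] 𝟙 (δ i)) * a + (∑[ i < n ] 𝟙 (not (δ i))) * c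
∑<-select zero    δ a c = refl
∑<-select (suc n) δ a c rewrite ∑<-select n (λ i → δ (suc i)) a c with δ 0
... | true  = sym (+-assoc a _ _)
... | false = x∙yz≈y∙xz c ((∑[ i < n ] 𝟙 (δ (suc i))) * a) ((∑[ i < n ] 𝟙 (not (δ (suc i)))) * c)

∑<-𝟙+𝟙-not : ∀ n (δ : ℕ → Bool) → (∑[ i < n ] 𝟙 (δ i)) + (∑[ i < n ] 𝟙 (not (δ i))) ≡ n
∑<-𝟙+𝟙-not zero    δ = refl
∑<-𝟙+𝟙-not (suc n) δ with δ 0
... | true  = cong suc (∑<-𝟙+𝟙-not n (λ i → δ (suc i)))
... | false = trans (+-suc _ _) (cong suc (∑<-𝟙+𝟙-not n (λ i → δ (suc i))))

-- Boolean predicates on lists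

∧-≡-true : ∀ {a b} → a ∧ b ≡ true → a ≡ true × b ≡ true
∧-≡-true {true} h = refl , h

∧-intro : ∀ {a b} → a ≡ true → b ≡ true → a ∧ b ≡ true
∧-intro refl refl = refl

not-≡-true : ∀ {a} → not a ≡ true → a ≡ false
not-≡-true {false} _ = refl

≡-true⇒T : ∀ {a} → a ≡ true → T a
≡-true⇒T refl = _

T⇒≡-true : ∀ {a} → T a → a ≡ true
T⇒≡-true {true} _ = refl

≡ᵇ-comm : ∀ m n → (m ≡ᵇ n) ≡ (n ≡ᵇ m)
≡ᵇ-comm zero    zero    = refl
≡ᵇ-comm zero    (suc n) = refl
≡ᵇ-comm (suc m) zero    = refl
≡ᵇ-comm (suc m) (suc n) = ≡ᵇ-comm m n

≡ᵇ-true⇒≡ : ∀ m n → (m ≡ᵇ n) ≡ true → m ≡ n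
≡ᵇ-true⇒≡ m n h = ≡ᵇ⇒≡ m n (≡-true⇒T h)

module _ where
  open ∨-∧-Solver

  ∧-interchange : ∀ a b c d → (a ∧ b) ∧ (c ∧ d) ≡ (a ∧ c) ∧ (b ∧ d)
  ∧-interchange = solve 4 (λ a b c d → (a :* b) :* (c :* d) := (a :* c) :* (b :* d)) refl

  ∧-left-comm : ∀ a b c → a ∧ (b ∧ c) ≡ b ∧ (a ∧ c)
  ∧-left-comm = solve 3 (λ a b c → a :* (b :* c) := b :* (a :* c)) refl

  ∧-right-comm : ∀ a b c → (a ∧ b) ∧ c ≡ (a ∧ c) ∧ b
  ∧-right-comm = solve 3 (λ a b c → (a :* b) :* c := (a :* c) :* b) refl

  ∨-left-comm : ∀ a b c → a ∨ (b ∨ c) ≡ b ∨ (a ∨ c)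
  ∨-left-comm = solve 3 (λ a b c → a :+ (b :+ c) := b :+ (a :+ c)) refl

n<ᵇ1+n : ∀ n → (n <ᵇ suc n) ≡ true
n<ᵇ1+n n = T⇒≡-true (<⇒<ᵇ (n<1+n n))

n<ᵇn : ∀ n → (n <ᵇ n) ≡ false
n<ᵇn zero    = refl
n<ᵇn (suc n) = n<ᵇn n

module _ {A : Set} where

  all-map : ∀ {B : Set} (p : B → Bool) (f : A → B) xs → all p (map f xs) ≡ all (λ x → p (f x)) xs
  all-map p f []       = refl
  all-map p f (x ∷ xs) = cong (p (f x) ∧_) (all-map p f xs)

  all-cong : ∀ {p q : A → Bool} xs → (∀ x → p x ≡ q x) → all p xs ≡ all q xs
  all-cong []       eq = refl
  all-cong (x ∷ xs) eq = cong₂ _∧_ (eq x) (all-cong xs eq)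

  all-∧ : ∀ (p q : A → Bool) xs → all (λ x → p x ∧ q x) xs ≡ all p xs ∧ all q xs
  all-∧ p q []       = refl
  all-∧ p q (x ∷ xs) rewrite all-∧ p q xs = ∧-interchange (p x) (q x) (all p xs) (all q xs)

  all-mono : ∀ {p q : A → Bool} xs → (∀ x → p x ≡ true → q x ≡ true) →
             all p xs ≡ true → all q xs ≡ true
  all-mono []       p⇒q h = refl
  all-mono (x ∷ xs) p⇒q h with ∧-≡-true h
  ... | px , pxs = ∧-intro (p⇒q x px) (all-mono xs p⇒q pxs)

  all-filterᵇ : ∀ {p q : A → Bool} (r : A → Bool) xs →
                (∀ x → p x ≡ true → r x ≡ true → q x ≡ true) →
                all p xs ≡ true → all q (filterᵇ r xs) ≡ true
  all-filterᵇ r []       pr⇒q h = refl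
  all-filterᵇ r (x ∷ xs) pr⇒q h with r x in rx | ∧-≡-true h
  ... | true  | px , pxs = ∧-intro (pr⇒q x px rx) (all-filterᵇ r xs pr⇒q pxs)
  ... | false | _  , pxs = all-filterᵇ r xs pr⇒q pxs

  all-++ : ∀ (p : A → Bool) xs ys → all p (xs ++ ys) ≡ all p xs ∧ all p ys
  all-++ p []       ys = refl
  all-++ p (x ∷ xs) ys rewrite all-++ p xs ys = sym (∧-assoc (p x) (all p xs) (all p ys))

  ∑-cong-all : ∀ (p : A → Bool) xs {f g : A → ℕ} → all p xs ≡ true →
               (∀ x → p x ≡ true → f x ≡ g x) → ∑ xs f ≡ ∑ xs g
  ∑-cong-all p []       h eq = refl
  ∑-cong-all p (x ∷ xs) h eq with ∧-≡-true h
  ... | px , pxs = cong₂ _+_ (eq x px) (∑-cong-all p xs pxs eq)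

not-elemᵇ : ∀ c xs → not (elemᵇ c xs) ≡ all (λ y → not (c ≡ᵇ y)) xs
not-elemᵇ c []       = refl
not-elemᵇ c (y ∷ ys) with c ≡ᵇ y
... | true  = refl
... | false = not-elemᵇ c ys

insert : {A : Set} → ℕ → A → List A → List A
insert zero    x ys       = x ∷ ys
insert (suc i) x []       = x ∷ []
insert (suc i) x (y ∷ ys) = y ∷ insert i x ys

insertᵛ : {A : Set} {n : ℕ} → ℕ → A → Vec A n → Vec A (suc n)
insertᵛ zero    x ys       = x ∷ ys
insertᵛ (suc i) x []       = x ∷ []
insertᵛ (suc i) x (y ∷ ys) = y ∷ insertᵛ i x ys

toList-insertᵛ : {A : Set} {n : ℕ} (i : ℕ) (x : A) (ys : Vec A n) →
                 toList (insertᵛ i x ys) ≡ insert i x (toList ys)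
toList-insertᵛ zero    x ys       = refl
toList-insertᵛ (suc i) x []       = refl
toList-insertᵛ (suc i) x (y ∷ ys) = cong (y ∷_) (toList-insertᵛ i x ys)

map-insert : {A B : Set} (f : A → B) (i : ℕ) (x : A) (ys : List A) →
             map f (insert i x ys) ≡ insert i (f x) (map f ys)
map-insert f zero    x ys       = refl
map-insert f (suc i) x []       = refl
map-insert f (suc i) x (y ∷ ys) = cong (f y ∷_) (map-insert f i x ys)

all-insert : {A : Set} (p : A → Bool) (i : ℕ) (x : A) (ys : List A) → all p (insert i x ys) ≡ p x ∧ all p ys
all-insert p zero    x ys       = refl
all-insert p (suc i) x []       = refl
all-insert p (suc i) x (y ∷ ys) rewrite all-insert p i x ys = ∧-left-comm (p y) (p x) (all p ys)

elemᵇ-insert : ∀ z i x ys → elemᵇ z (insert i x ys) ≡ (z ≡ᵇ x) ∨ elemᵇ z ys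
elemᵇ-insert z zero    x ys       = refl
elemᵇ-insert z (suc i) x []       = refl
elemᵇ-insert z (suc i) x (y ∷ ys) rewrite elemᵇ-insert z i x ys =
  ∨-left-comm (z ≡ᵇ y) (z ≡ᵇ x) (elemᵇ z ys)

distinctᵇ-insert : ∀ i x ys → distinctᵇ (insert i x ys) ≡ not (elemᵇ x ys) ∧ distinctᵇ ys
distinctᵇ-insert zero    x ys       = refl
distinctᵇ-insert (suc i) x []       = refl
distinctᵇ-insert (suc i) x (y ∷ ys)
  rewrite elemᵇ-insert y i x ys | distinctᵇ-insert i x ys | ≡ᵇ-comm y x =
  swap (x ≡ᵇ y) (elemᵇ y ys) (elemᵇ x ys) (distinctᵇ ys)
  where
  swap : ∀ a b c d → not (a ∨ b) ∧ (not c ∧ d) ≡ not (a ∨ c) ∧ (not b ∧ d)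
  swap true  b     c     d = refl
  swap false true  true  d = refl
  swap false true  false d = refl
  swap false false c     d = refl

count : ℕ → List ℕ → ℕ
count c xs = ∑[ y ∈ xs ] 𝟙 (c ≡ᵇ y)

without : ℕ → List ℕ → List ℕ
without c = filterᵇ (λ y → not (c ≡ᵇ y))

length≡count+length-without : ∀ c xs → length xs ≡ count c xs + length (without c xs)
length≡count+length-without c []       = refl
length≡count+length-without c (x ∷ xs) with c ≡ᵇ x
... | true  = cong suc (length≡count+length-without c xs)
... | false = trans (cong suc (length≡count+length-without c xs)) (sym (+-suc _ _))

count-absent : ∀ c xs → elemᵇ c xs ≡ false → count c xs ≡ 0
count-absent c []       h = refl
count-absent c (x ∷ xs) h with c ≡ᵇ x
... | false = count-absent c xs h

count-distinct≤1 : ∀ c xs → distinctᵇ xs ≡ true → count c xs ≤ 1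
count-distinct≤1 c []       h = z≤n
count-distinct≤1 c (x ∷ xs) h with c ≡ᵇ x in c≡x | ∧-≡-true h
... | true  | x∉xs , _ rewrite ≡ᵇ-true⇒≡ c x c≡x | count-absent x xs (not-≡-true x∉xs) = s≤s z≤n
... | false | _ , dxs = count-distinct≤1 c xs dxs

elemᵇ-filterᵇ : ∀ (q : ℕ → Bool) y ys → elemᵇ y ys ≡ false → elemᵇ y (filterᵇ q ys) ≡ false
elemᵇ-filterᵇ q y []       h = refl
elemᵇ-filterᵇ q y (z ∷ zs) h with y ≡ᵇ z in y≡z | q z
... | false | true  = trans (cong (_∨ elemᵇ y (filterᵇ q zs)) y≡z) (elemᵇ-filterᵇ q y zs h)
... | false | false = elemᵇ-filterᵇ q y zs h

distinctᵇ-filterᵇ : ∀ (q : ℕ → Bool) ys → distinctᵇ ys ≡ true → distinctᵇ (filterᵇ q ys) ≡ true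
distinctᵇ-filterᵇ q []       h = refl
distinctᵇ-filterᵇ q (z ∷ zs) h with q z | ∧-≡-true h
... | true  | z∉zs , dzs =
  ∧-intro (cong not (elemᵇ-filterᵇ q z zs (not-≡-true z∉zs))) (distinctᵇ-filterᵇ q zs dzs)
... | false | _    , dzs = distinctᵇ-filterᵇ q zs dzs

inIntervalᵇ : ℕ → ℕ → Bool
inIntervalᵇ B x = (0 <ᵇ x) ∧ (x <ᵇ suc B)

<ᵇ-suc-≢ : ∀ B x → (x <ᵇ suc (suc B)) ∧ not (suc B ≡ᵇ x) ≡ (x <ᵇ suc B)
<ᵇ-suc-≢ B       zero          = refl
<ᵇ-suc-≢ zero    (suc zero)    = refl
<ᵇ-suc-≢ zero    (suc (suc x)) = refl
<ᵇ-suc-≢ (suc B) (suc x)       = <ᵇ-suc-≢ B x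

inIntervalᵇ-without : ∀ B x → inIntervalᵇ (suc B) x ∧ not (suc B ≡ᵇ x) ≡ inIntervalᵇ B x
inIntervalᵇ-without B x = trans (∧-assoc (0 <ᵇ x) _ _) (cong ((0 <ᵇ x) ∧_) (<ᵇ-suc-≢ B x))

distinct⇒length≤ : ∀ B ns → distinctᵇ ns ≡ true → all (inIntervalᵇ B) ns ≡ true → length ns ≤ B
length-without≤ : ∀ B ns → distinctᵇ ns ≡ true → all (inIntervalᵇ (suc B)) ns ≡ true →
                  length (without (suc B) ns) ≤ B

distinct⇒length≤ zero    []           d a  = z≤n
distinct⇒length≤ zero    (zero  ∷ ns) d ()
distinct⇒length≤ zero    (suc x ∷ ns) d ()
distinct⇒length≤ (suc B) ns           d a  = begin
  length ns                                      ≡⟨ length≡count+length-without (suc B) ns ⟩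
  count (suc B) ns + length (without (suc B) ns)
    ≤⟨ +-mono-≤ (count-distinct≤1 (suc B) ns d) (length-without≤ B ns d a) ⟩
  suc B                                          ∎
  where open ≤-Reasoning

length-without≤ B ns d a =
  distinct⇒length≤ B (without (suc B) ns) (distinctᵇ-filterᵇ _ ns d)
    (all-filterᵇ _ ns (λ x x∈ x≢ → trans (sym (inIntervalᵇ-without B x)) (∧-intro x∈ x≢)) a)

count-top≡1 : ∀ m ns → distinctᵇ ns ≡ true → all (inIntervalᵇ (suc m)) ns ≡ true →
              length ns ≡ suc m → count (suc m) ns ≡ 1
count-top≡1 m ns d a len = ≤-antisym (count-distinct≤1 (suc m) ns d) (+-cancelʳ-≤ m 1 (count (suc m) ns) 1+m≤)
  where
  open ≤-Reasoning
  1+m≤ : suc m ≤ count (suc m) ns + m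
  1+m≤ = begin
    suc m                                          ≡⟨ sym len ⟩
    length ns                                      ≡⟨ length≡count+length-without (suc m) ns ⟩
    count (suc m) ns + length (without (suc m) ns) ≤⟨ +-monoʳ-≤ (count (suc m) ns) (length-without≤ m ns d a) ⟩
    count (suc m) ns + m                           ∎

-- Vectors over the range −m … m

∑-allVecs-suc : ∀ r l (f : Vec ℤ (suc l) → ℕ) →
  ∑ (allVecs r (suc l)) f ≡ ∑[ x ∈ r ] ∑[ w ∈ allVecs r l ] f (x ∷ w)
∑-allVecs-suc r l f = trans (∑-concatMap _ r f) (∑-cong r (λ x → ∑-map (x ∷_) (allVecs r l) f))

module RemoveMarked (R : List ℤ) (e : ℤ) (marked : ℤ → Bool)
                    (marked-unique : ∀ (g : ℤ → ℕ) → ∑[ x ∈ R ] 𝟙 (marked x) * g x ≡ g e) where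

  occurrences : ∀ {n} → Vec ℤ n → ℕ
  occurrences v = ∑[ x ∈ toList v ] 𝟙 (marked x)

  -- Double counting: v with c marked entries is insertᵛ i e w for exactly c pairs (i , w).
  ∑-occurrences : ∀ l (H : Vec ℤ (suc l) → ℕ) →
    ∑[ v ∈ allVecs R (suc l) ] occurrences v * H v
      ≡ ∑[ i < suc l ] ∑[ w ∈ allVecs R l ] H (insertᵛ i e w)
  ∑-occurrences-tail : ∀ l (H : Vec ℤ (suc l) → ℕ) →
    ∑[ x ∈ R ] ∑[ w ∈ allVecs R l ] occurrences w * H (x ∷ w)
      ≡ ∑[ i < l ] ∑[ w ∈ allVecs R l ] H (insertᵛ (suc i) e w)

  ∑-occurrences l H = begin
    ∑[ v ∈ allVecs R (suc l) ] occurrences v * H v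
      ≡⟨ ∑-allVecs-suc R l _ ⟩
    ∑[ x ∈ R ] ∑[ w ∈ W ] (𝟙 (marked x) + occurrences w) * H (x ∷ w)
      ≡⟨ ∑-cong R split-head ⟩
    ∑[ x ∈ R ] (𝟙 (marked x) * headed x + rest x)
      ≡⟨ ∑-+ R (λ x → 𝟙 (marked x) * headed x) rest ⟩
    (∑[ x ∈ R ] 𝟙 (marked x) * headed x) + ∑ R rest
      ≡⟨ cong₂ _+_ (marked-unique headed) (∑-occurrences-tail l H) ⟩
    headed e + (∑[ i < l ] ∑[ w ∈ W ] H (insertᵛ (suc i) e w)) ∎
    where
    open ≡-Reasoning
    W = allVecs R l
    headed rest : ℤ → ℕ
    headed x = ∑[ w ∈ W ] H (x ∷ w)
    rest   x = ∑[ w ∈ W ] occurrences w * H (x ∷ w)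
    split-head : ∀ x → ∑[ w ∈ W ] (𝟙 (marked x) + occurrences w) * H (x ∷ w) ≡ 𝟙 (marked x) * headed x + rest x
    split-head x = begin
      ∑[ w ∈ W ] (𝟙 (marked x) + occurrences w) * H (x ∷ w)
        ≡⟨ ∑-cong W (λ w → *-distribʳ-+ (H (x ∷ w)) (𝟙 (marked x)) (occurrences w)) ⟩
      ∑[ w ∈ W ] (𝟙 (marked x) * H (x ∷ w) + occurrences w * H (x ∷ w))
        ≡⟨ ∑-+ W (λ w → 𝟙 (marked x) * H (x ∷ w)) (λ w → occurrences w * H (x ∷ w)) ⟩
      (∑[ w ∈ W ] 𝟙 (marked x) * H (x ∷ w)) + rest x
        ≡⟨ cong₂ _+_ (∑-*ˡ W (𝟙 (marked x)) (λ w → H (x ∷ w))) refl ⟩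
      𝟙 (marked x) * headed x + rest x ∎

  ∑-occurrences-tail zero    H = ∑-zero R
  ∑-occurrences-tail (suc l) H = begin
    ∑[ x ∈ R ] ∑[ w ∈ allVecs R (suc l) ] occurrences w * H (x ∷ w)
      ≡⟨ ∑-cong R (λ x → ∑-occurrences l (λ w → H (x ∷ w))) ⟩
    ∑[ x ∈ R ] ∑[ i < suc l ] ∑[ w ∈ allVecs R l ] H (x ∷ insertᵛ i e w)
      ≡⟨ ∑-∑<-comm R (suc l) (λ x i → ∑[ w ∈ allVecs R l ] H (x ∷ insertᵛ i e w)) ⟩
    ∑[ i < suc l ] ∑[ x ∈ R ] ∑[ w ∈ allVecs R l ] H (insertᵛ (suc i) e (x ∷ w))
      ≡⟨ ∑<-cong (suc l) (λ i → sym (∑-allVecs-suc R l (λ w → H (insertᵛ (suc i) e w)))) ⟩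
    ∑[ i < suc l ] ∑[ w ∈ allVecs R (suc l) ] H (insertᵛ (suc i) e w) ∎
    where open ≡-Reasoning

boundedᵇ : ℕ → ℤ → Bool
boundedᵇ m x = ∣ x ∣ <ᵇ suc m

applyUpTo-cong : {A : Set} {f g : ℕ → A} → ∀ n → (∀ i → f i ≡ g i) → applyUpTo f n ≡ applyUpTo g n
applyUpTo-cong zero    eq = refl
applyUpTo-cong (suc n) eq = cong₂ _∷_ (eq 0) (applyUpTo-cong n (λ i → eq (suc i)))

range-suc : ∀ m → range (suc m) ≡ -[1+ m ] ∷ (range m ∷ʳ + suc m)
range-suc m = begin
  range (suc m)
    ≡⟨ map-applyUpTo (λ i → i) f (suc (suc m + suc m)) ⟩
  applyUpTo f (suc (suc m + suc m))
    ≡⟨ cong (λ n → applyUpTo f (suc (suc n))) (+-suc m m) ⟩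
  f 0 ∷ applyUpTo (λ i → f (suc i)) (suc (suc (m + m)))
    ≡⟨ cong (f 0 ∷_) (sym (applyUpTo-∷ʳ (λ i → f (suc i)) (suc (m + m)))) ⟩
  f 0 ∷ (applyUpTo (λ i → f (suc i)) (suc (m + m)) ∷ʳ f (suc (suc (m + m))))
    ≡⟨ cong₂ (λ xs x → -[1+ m ] ∷ (xs ∷ʳ x)) middle top ⟩
  -[1+ m ] ∷ (range m ∷ʳ + suc m) ∎
  where
  open ≡-Reasoning
  f : ℕ → ℤ
  f i = + i - + suc m
  middle : applyUpTo (λ i → f (suc i)) (suc (m + m)) ≡ range m
  middle = trans (applyUpTo-cong (suc (m + m))
                   (λ i → trans (ℤ.[1+m]⊖[1+n]≡m⊖n i m) (sym (ℤ.m-n≡m⊖n i m))))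
                 (sym (map-applyUpTo (λ i → i) (λ i → + i - + m) (suc (m + m))))
  top : f (suc (suc (m + m))) ≡ + suc m
  top = trans (ℤ.[1+m]⊖[1+n]≡m⊖n (suc (m + m)) m)
              (trans (ℤ.⊖-≥ (≤-trans (m≤m+n m m) (n≤1+n _)))
                     (cong +_ (trans (cong (_∸ m) (sym (+-suc m m))) (m+n∸m≡n m (suc m)))))

∑-range-suc : ∀ m (g : ℤ → ℕ) → ∑ (range (suc m)) g ≡ g -[1+ m ] + (∑ (range m) g + g (+ suc m))
∑-range-suc m g = trans (cong (λ xs → ∑ xs g) (range-suc m))
  (cong (_+_ (g -[1+ m ]))
        (trans (∑-++ (range m) (+ suc m ∷ []) g) (cong (_+_ (∑ (range m) g)) (+-identityʳ _))))

all-range-bounded : ∀ m → all (boundedᵇ m) (range m) ≡ true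
all-range-bounded zero = refl
all-range-bounded (suc m) = trans (cong (all (boundedᵇ (suc m))) (range-suc m))
  (∧-intro (n<ᵇ1+n m) (trans (all-++ (boundedᵇ (suc m)) (range m) (+ suc m ∷ []))
    (∧-intro (all-mono (range m) bounded-suc (all-range-bounded m)) (∧-intro (n<ᵇ1+n m) refl))))
  where
  bounded-suc : ∀ x → boundedᵇ m x ≡ true → boundedᵇ (suc m) x ≡ true
  bounded-suc x h = T⇒≡-true (<⇒<ᵇ (m<n⇒m<1+n (<ᵇ⇒< ∣ x ∣ (suc m) (≡-true⇒T h))))

∑-allVecs-range-suc : ∀ m l (G : Vec ℤ l → ℕ) →
  (∀ w → all (boundedᵇ m) (toList w) ≡ false → G w ≡ 0) →
  ∑ (allVecs (range (suc m)) l) G ≡ ∑ (allVecs (range m) l) G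
∑-allVecs-range-suc m zero    G G-vanishes = refl
∑-allVecs-range-suc m (suc l) G G-vanishes = begin
  ∑ (allVecs (range (suc m)) (suc l)) G            ≡⟨ ∑-allVecs-suc (range (suc m)) l G ⟩
  ∑ (range (suc m)) G₁                             ≡⟨ ∑-range-suc m G₁ ⟩
  G₁ -[1+ m ] + (∑ (range m) G₁ + G₁ (+ suc m))
    ≡⟨ cong₂ _+_ (G₁-unbounded -[1+ m ] refl)
                 (cong₂ _+_ (∑-cong (range m) G₁-restrict) (G₁-unbounded (+ suc m) refl)) ⟩
  (∑[ x ∈ range m ] ∑[ w ∈ allVecs (range m) l ] G (x ∷ w)) + 0 ≡⟨ +-identityʳ _ ⟩
  ∑[ x ∈ range m ] ∑[ w ∈ allVecs (range m) l ] G (x ∷ w)      ≡⟨ sym (∑-allVecs-suc (range m) l G) ⟩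
  ∑ (allVecs (range m) (suc l)) G                  ∎
  where
  open ≡-Reasoning
  G₁ : ℤ → ℕ
  G₁ x = ∑[ w ∈ allVecs (range (suc m)) l ] G (x ∷ w)
  G₁-unbounded : ∀ x → ∣ x ∣ ≡ suc m → G₁ x ≡ 0
  G₁-unbounded x ∣x∣≡1+m =
    trans (∑-cong (allVecs (range (suc m)) l) (λ w → G-vanishes (x ∷ w) x-unbounded))
          (∑-zero (allVecs (range (suc m)) l))
    where
    x-unbounded : ∀ {b} → boundedᵇ m x ∧ b ≡ false
    x-unbounded {b} = cong (_∧ b) (trans (cong (_<ᵇ suc m) ∣x∣≡1+m) (n<ᵇn m))
  G₁-restrict : ∀ x → G₁ x ≡ ∑[ w ∈ allVecs (range m) l ] G (x ∷ w)
  G₁-restrict x = ∑-allVecs-range-suc m l (λ w → G (x ∷ w))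
    (λ w h → G-vanishes (x ∷ w) (trans (cong (boundedᵇ m x ∧_) h) (∧-zeroʳ (boundedᵇ m x))))

-- Signed permutations with a prescribed set of negative values

signOKᵇ : ∀ {m} → Subset m → ℤ → Bool
signOKᵇ U x = iffᵇ ⌊ x <? + 0 ⌋ (memb U ∣ x ∣)

entryOKᵇ : ∀ {m} → Subset m → ℤ → Bool
entryOKᵇ {m} U x = inIntervalᵇ m ∣ x ∣ ∧ signOKᵇ U x

signedPermWith : ∀ {n} → Subset n → Vec ℤ n → Bool
signedPermWith {n} U v = isSignedPerm n v ∧ signCond U v

signedPermWith≡ : ∀ {n} (U : Subset n) v →
  signedPermWith U v ≡ all (entryOKᵇ U) (toList v) ∧ distinctᵇ (map ∣_∣ (toList v))
signedPermWith≡ {n} U v =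
  trans (∧-right-comm (all inInterval l) (distinctᵇ (map ∣_∣ l)) (all (signOKᵇ U) l))
        (cong (_∧ distinctᵇ (map ∣_∣ l)) (sym (all-∧ inInterval (signOKᵇ U) l)))
  where
  l = toList v
  inInterval = λ (x : ℤ) → inIntervalᵇ n ∣ x ∣

memb-last : ∀ m (U : Subset (suc m)) → memb U (suc m) ≡ last U
memb-last zero    (s ∷ [])    = refl
memb-last (suc m) (s ∷ t ∷ U) = memb-last m (t ∷ U)

memb-init : ∀ m (U : Subset (suc m)) j → j ≤ m → memb U j ≡ memb (init U) j
memb-init zero    (s ∷ [])    zero          z≤n     = refl
memb-init (suc m) (s ∷ t ∷ U) zero          _       = refl
memb-init (suc m) (s ∷ t ∷ U) (suc zero)    _       = refl
memb-init (suc m) (s ∷ t ∷ U) (suc (suc j)) (s≤s h) = memb-init m (t ∷ U) (suc j) h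

extreme : ℕ → Bool → ℤ
extreme m true  = -[1+ m ]
extreme m false = + suc m

-- The sign condition leaves only one candidate of absolute value m + 1.
≟-extreme : ∀ m {n} (U : Subset n) s → memb U (suc m) ≡ s → ∀ x → signOKᵇ U x ≡ true →
            ⌊ x ℤ.≟ extreme m s ⌋ ≡ (suc m ≡ᵇ ∣ x ∣)
≟-extreme m U false mb (+ j) h = trans (isYes≗does (+ j ℤ.≟ + suc m)) (≡ᵇ-comm j (suc m))
≟-extreme m U true  mb (+ j) h with suc m ≡ᵇ j in m+1≡j
... | false = refl
... | true rewrite sym (≡ᵇ-true⇒≡ (suc m) j m+1≡j) | mb with h
...   | ()
≟-extreme m U true  mb -[1+ j ] h = trans (isYes≗does (-[1+ j ] ℤ.≟ -[1+ m ])) (≡ᵇ-comm j m)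
≟-extreme m U false mb -[1+ j ] h with m ≡ᵇ j in m≡j
... | false = refl
... | true rewrite sym (≡ᵇ-true⇒≡ m j m≡j) | mb with h
...   | ()

count-extreme≡1 : ∀ m (U : Subset (suc m)) v → signedPermWith U v ≡ true →
                  ∑[ x ∈ toList v ] 𝟙 ⌊ x ℤ.≟ extreme m (last U) ⌋ ≡ 1
count-extreme≡1 m U v h with ∧-≡-true (trans (sym (signedPermWith≡ U v)) h)
... | entriesOK , distinct = begin
  ∑[ x ∈ l ] 𝟙 ⌊ x ℤ.≟ extreme m (last U) ⌋
    ≡⟨ ∑-cong-all (entryOKᵇ U) l entriesOK (λ x x-ok →
         cong 𝟙 (≟-extreme m U (last U) (memb-last m U) x (proj₂ (∧-≡-true x-ok)))) ⟩
  ∑[ x ∈ l ] 𝟙 (suc m ≡ᵇ ∣ x ∣)  ≡⟨ sym (∑-map ∣_∣ l (λ y → 𝟙 (suc m ≡ᵇ y))) ⟩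
  count (suc m) (map ∣_∣ l)      ≡⟨ count-top≡1 m (map ∣_∣ l) distinct inInterval length-l ⟩
  1                              ∎
  where
  open ≡-Reasoning
  l = toList v
  inInterval : all (inIntervalᵇ (suc m)) (map ∣_∣ l) ≡ true
  inInterval = trans (all-map _ ∣_∣ l) (all-mono l (λ x x-ok → proj₁ (∧-≡-true x-ok)) entriesOK)
  length-l : length (map ∣_∣ l) ≡ suc m
  length-l = trans (length-map ∣_∣ l) (length-toList v)

entryOKᵇ-init : ∀ m (U : Subset (suc m)) x →
                entryOKᵇ U x ∧ not (suc m ≡ᵇ ∣ x ∣) ≡ entryOKᵇ (init U) x
entryOKᵇ-init m U x =
  trans (∧-right-comm (inIntervalᵇ (suc m) ∣ x ∣) (signOKᵇ U x) (not (suc m ≡ᵇ ∣ x ∣)))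
        (trans (cong (_∧ signOKᵇ U x) (inIntervalᵇ-without m ∣ x ∣)) signOK-init)
  where
  signOK-init : inIntervalᵇ m ∣ x ∣ ∧ signOKᵇ U x ≡ entryOKᵇ (init U) x
  signOK-init with inIntervalᵇ m ∣ x ∣ in x-ok
  ... | false = refl
  ... | true  = cong (iffᵇ ⌊ x <? + 0 ⌋) (memb-init m U ∣ x ∣ ∣x∣≤m)
    where
    ∣x∣≤m : ∣ x ∣ ≤ m
    ∣x∣≤m = s≤s⁻¹ (<ᵇ⇒< ∣ x ∣ (suc m) (≡-true⇒T (proj₂ (∧-≡-true x-ok))))

∣extreme∣ : ∀ m s → ∣ extreme m s ∣ ≡ suc m
∣extreme∣ m true  = refl
∣extreme∣ m false = refl

entryOKᵇ-extreme : ∀ m (U : Subset (suc m)) → entryOKᵇ U (extreme m (last U)) ≡ true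
entryOKᵇ-extreme m U = ∧-intro inInterval (signOK (last U) (memb-last m U))
  where
  inInterval : inIntervalᵇ (suc m) ∣ extreme m (last U) ∣ ≡ true
  inInterval rewrite ∣extreme∣ m (last U) = n<ᵇ1+n (suc m)
  signOK : ∀ s → memb U (suc m) ≡ s → signOKᵇ U (extreme m s) ≡ true
  signOK true  mb rewrite mb = refl
  signOK false mb rewrite mb = refl

signedPermWith-insert : ∀ m (U : Subset (suc m)) i (w : Vec ℤ m) →
  signedPermWith U (insertᵛ i (extreme m (last U)) w) ≡ signedPermWith (init U) w
signedPermWith-insert m U i w = begin
  signedPermWith U (insertᵛ i e w)
    ≡⟨ signedPermWith≡ U (insertᵛ i e w) ⟩
  all (entryOKᵇ U) (toList (insertᵛ i e w)) ∧ distinctᵇ (map ∣_∣ (toList (insertᵛ i e w)))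
    ≡⟨ cong (λ l′ → all (entryOKᵇ U) l′ ∧ distinctᵇ (map ∣_∣ l′)) (toList-insertᵛ i e w) ⟩
  all (entryOKᵇ U) (insert i e l) ∧ distinctᵇ (map ∣_∣ (insert i e l))
    ≡⟨ cong₂ _∧_ (all-insert (entryOKᵇ U) i e l)
                 (trans (cong distinctᵇ (map-insert ∣_∣ i e l)) (distinctᵇ-insert i ∣ e ∣ (map ∣_∣ l))) ⟩
  (entryOKᵇ U e ∧ all (entryOKᵇ U) l) ∧ (not (elemᵇ ∣ e ∣ (map ∣_∣ l)) ∧ D)
    ≡⟨ cong₂ (λ a b → (a ∧ all (entryOKᵇ U) l) ∧ (b ∧ D)) (entryOKᵇ-extreme m U) e∉l ⟩
  all (entryOKᵇ U) l ∧ (all N l ∧ D)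
    ≡⟨ sym (∧-assoc (all (entryOKᵇ U) l) (all N l) D) ⟩
  (all (entryOKᵇ U) l ∧ all N l) ∧ D
    ≡⟨ cong (_∧ D) (sym (all-∧ (entryOKᵇ U) N l)) ⟩
  all (λ x → entryOKᵇ U x ∧ N x) l ∧ D
    ≡⟨ cong (_∧ D) (all-cong l (entryOKᵇ-init m U)) ⟩
  all (entryOKᵇ (init U)) l ∧ D
    ≡⟨ sym (signedPermWith≡ (init U) w) ⟩
  signedPermWith (init U) w ∎
  where
  open ≡-Reasoning
  e = extreme m (last U)
  l = toList w
  D = distinctᵇ (map ∣_∣ l)
  N = λ (x : ℤ) → not (suc m ≡ᵇ ∣ x ∣)
  e∉l : not (elemᵇ ∣ e ∣ (map ∣_∣ l)) ≡ all N l
  e∉l = trans (cong (λ c → not (elemᵇ c (map ∣_∣ l))) (∣extreme∣ m (last U)))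
              (trans (not-elemᵇ (suc m) (map ∣_∣ l)) (all-map _ ∣_∣ l))

⌊≟⌋-refl : ∀ x → ⌊ x ℤ.≟ x ⌋ ≡ true
⌊≟⌋-refl x = trans (isYes≗does (x ℤ.≟ x)) (dec-true (x ℤ.≟ x) refl)

⌊≟-extreme⌋-bounded : ∀ m s x → boundedᵇ m x ≡ true → ⌊ x ℤ.≟ extreme m s ⌋ ≡ false
⌊≟-extreme⌋-bounded m s x h = trans (isYes≗does (x ℤ.≟ extreme m s)) (dec-false (x ℤ.≟ extreme m s)
  (λ x≡e → <-irrefl (trans (cong ∣_∣ x≡e) (∣extreme∣ m s)) (<ᵇ⇒< ∣ x ∣ (suc m) (≡-true⇒T h))))

extreme-unique : ∀ m s (g : ℤ → ℕ) →
                 ∑[ x ∈ range (suc m) ] 𝟙 ⌊ x ℤ.≟ extreme m s ⌋ * g x ≡ g (extreme m s)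
extreme-unique m s g = begin
  ∑ (range (suc m)) (φ s)                             ≡⟨ ∑-range-suc m (φ s) ⟩
  φ s -[1+ m ] + (∑ (range m) (φ s) + φ s (+ suc m))  ≡⟨ cong (λ z → φ s -[1+ m ] + (z + φ s (+ suc m))) interior ⟩
  φ s -[1+ m ] + φ s (+ suc m)                        ≡⟨ endpoints s ⟩
  g (extreme m s)                                     ∎
  where
  open ≡-Reasoning
  φ : Bool → ℤ → ℕ
  φ t x = 𝟙 ⌊ x ℤ.≟ extreme m t ⌋ * g x
  interior : ∑ (range m) (φ s) ≡ 0
  interior = trans (∑-cong-all (boundedᵇ m) (range m) (all-range-bounded m)
                     (λ x h → cong (λ c → 𝟙 c * g x) (⌊≟-extreme⌋-bounded m s x h)))
                   (∑-zero (range m))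
  endpoints : ∀ t → φ t -[1+ m ] + φ t (+ suc m) ≡ g (extreme m t)
  endpoints true  rewrite ⌊≟⌋-refl -[1+ m ]  = trans (+-identityʳ _) (+-identityʳ _)
  endpoints false rewrite ⌊≟⌋-refl (+ suc m) = +-identityʳ _

signedPermWith⇒bounded : ∀ {m} (U : Subset m) w →
                         signedPermWith U w ≡ true → all (boundedᵇ m) (toList w) ≡ true
signedPermWith⇒bounded U w h =
  all-mono (toList w) (λ x x-ok → proj₂ (∧-≡-true {0 <ᵇ ∣ x ∣} (proj₁ (∧-≡-true x-ok))))
    (proj₁ (∧-≡-true (trans (sym (signedPermWith≡ U w)) h)))

-- Descents under insertion of an extreme value

hasDes : ∀ {n} → ℤ → Vec ℤ n → ℕ
hasDes k v = 𝟙 ⌊ + des v ℤ.≟ k ⌋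

desFrom≤length : ∀ x l → desFrom x l ≤ length l
desFrom≤length x []       = z≤n
desFrom≤length x (y ∷ ys) with ⌊ y <? x ⌋
... | true  = s≤s (desFrom≤length y ys)
... | false = m≤n⇒m≤1+n (desFrom≤length y ys)

𝟙+𝟙-not : ∀ a n → 𝟙 a + (𝟙 (not a) + n) ≡ suc n
𝟙+𝟙-not true  n = refl
𝟙+𝟙-not false n = refl

𝟙-not+𝟙 : ∀ a n → 𝟙 (not a) + (𝟙 a + n) ≡ suc n
𝟙-not+𝟙 true  n = refl
𝟙-not+𝟙 false n = refl

module InsertExtremal (e : ℤ) (isMin : Bool) (admissible : ℤ → Bool)
         (compare : ∀ z → admissible z ≡ true → (⌊ e <? z ⌋ ≡ isMin) × (⌊ z <? e ⌋ ≡ not isMin)) where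

  -- Between two entries, e creates one descent and destroys the one already there, if any;
  -- at the end it creates one iff it is the minimum.
  raisesDes : ℤ → List ℤ → ℕ → Bool
  raisesDes x []       i       = isMin
  raisesDes x (y ∷ ys) zero    = not ⌊ y <? x ⌋
  raisesDes x (y ∷ ys) (suc i) = raisesDes y ys i

  desFrom-insert : ∀ x l i → admissible x ≡ true → all admissible l ≡ true →
                   desFrom x (insert i e l) ≡ 𝟙 (raisesDes x l i) + desFrom x l
  desFrom-insert x []       zero    x-ok l-ok rewrite proj₁ (compare x x-ok) = refl
  desFrom-insert x []       (suc i) x-ok l-ok rewrite proj₁ (compare x x-ok) = refl
  desFrom-insert x (y ∷ ys) zero    x-ok l-ok
    rewrite proj₁ (compare x x-ok) | proj₂ (compare y (proj₁ (∧-≡-true l-ok))) =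
    trans (𝟙+𝟙-not isMin (desFrom y ys)) (sym (𝟙-not+𝟙 ⌊ y <? x ⌋ (desFrom y ys)))
  desFrom-insert x (y ∷ ys) (suc i) x-ok l-ok with ∧-≡-true l-ok
  ... | y-ok , ys-ok rewrite desFrom-insert y ys i y-ok ys-ok =
    x∙yz≈y∙xz (𝟙 ⌊ y <? x ⌋) (𝟙 (raisesDes y ys i)) (desFrom y ys)

  ∑<-raisesDes : ∀ x l →
    (∑[ i < suc (length l) ] 𝟙 (raisesDes x l i)) + desFrom x l ≡ length l + 𝟙 isMin
  ∑<-raisesDes x []       = trans (+-identityʳ _) (+-identityʳ _)
  ∑<-raisesDes x (y ∷ ys) = begin
    (𝟙 (not a) + r) + (𝟙 a + desFrom y ys) ≡⟨ +-assoc (𝟙 (not a)) r _ ⟩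
    𝟙 (not a) + (r + (𝟙 a + desFrom y ys)) ≡⟨ cong (_+_ (𝟙 (not a))) (x∙yz≈y∙xz r (𝟙 a) (desFrom y ys)) ⟩
    𝟙 (not a) + (𝟙 a + (r + desFrom y ys)) ≡⟨ 𝟙-not+𝟙 a (r + desFrom y ys) ⟩
    suc (r + desFrom y ys)                 ≡⟨ cong suc (∑<-raisesDes y ys) ⟩
    suc (length ys + 𝟙 isMin)              ∎
    where
    open ≡-Reasoning
    a = ⌊ y <? x ⌋
    r = ∑[ i < suc (length ys) ] 𝟙 (raisesDes y ys i)

extreme-compare : ∀ m s z → boundedᵇ m z ≡ true →
                  (⌊ extreme m s <? z ⌋ ≡ s) × (⌊ z <? extreme m s ⌋ ≡ not s)
extreme-compare m false (+ j) h =
    trans (isYes≗does (+ suc m <? + j))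
          (dec-false (+ suc m <? + j) (λ { (ℤ.+<+ m<j) → <-asym m<j j≤m }))
  , trans (isYes≗does (+ j <? + suc m)) (dec-true (+ j <? + suc m) (ℤ.+<+ j≤m))
  where j≤m = <ᵇ⇒< j (suc m) (≡-true⇒T h)
extreme-compare m false -[1+ j ] h = refl , refl
extreme-compare m true  (+ j)    h = refl , refl
extreme-compare m true  -[1+ j ] h =
    trans (isYes≗does (-[1+ m ] <? -[1+ j ])) (dec-true (-[1+ m ] <? -[1+ j ]) (ℤ.-<- j<m))
  , trans (isYes≗does (-[1+ j ] <? -[1+ m ]))
          (dec-false (-[1+ j ] <? -[1+ m ]) (λ { (ℤ.-<- m<j) → <-asym m<j j<m }))
  where j<m = <ᵇ⇒< j m (≡-true⇒T h)

⌊+≟+⌋ : ∀ d k → ⌊ + d ℤ.≟ + k ⌋ ≡ (d ≡ᵇ k)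
⌊+≟+⌋ d k = isYes≗does (+ d ℤ.≟ + k)

⌊+≟+-1⌋ : ∀ d k → ⌊ + d ℤ.≟ + k - + 1 ⌋ ≡ (suc d ≡ᵇ k)
⌊+≟+-1⌋ d zero    = refl
⌊+≟+-1⌋ d (suc k) = ⌊+≟+⌋ d k

𝟙≡ᵇ-subst : ∀ x y (f : ℕ → ℕ) → f x * 𝟙 (x ≡ᵇ y) ≡ f y * 𝟙 (x ≡ᵇ y)
𝟙≡ᵇ-subst x y f with x ≡ᵇ y in x≡y
... | true  rewrite ≡ᵇ-true⇒≡ x y x≡y = refl
... | false = trans (*-zeroʳ (f x)) (sym (*-zeroʳ (f y)))

module InsertionCounts (m : ℕ) (s : Bool) (w : Vec ℤ m) (w-bounded : all (boundedᵇ m) (toList w) ≡ true) where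

  open InsertExtremal (extreme m s) s (boundedᵇ m) (extreme-compare m s)

  d : ℕ
  d = des w

  raises : ℕ → Bool
  raises = raisesDes (+ 0) (toList w)

  t f : ℕ
  t = ∑[ i < suc m ] 𝟙 (raises i)
  f = ∑[ i < suc m ] 𝟙 (not (raises i))

  des-insert : ∀ i → des (insertᵛ i (extreme m s) w) ≡ 𝟙 (raises i) + d
  des-insert i = trans (cong (desFrom (+ 0)) (toList-insertᵛ i (extreme m s) w))
    (desFrom-insert (+ 0) (toList w) i refl w-bounded)

  count-des : ∀ k → ∑[ i < suc m ] hasDes (+ k) (insertᵛ i (extreme m s) w)
                ≡ t * 𝟙 (suc d ≡ᵇ k) + f * 𝟙 (d ≡ᵇ k)
  count-des k =
    trans (∑<-cong (suc m) by-raises) (∑<-select (suc m) raises (𝟙 (suc d ≡ᵇ k)) (𝟙 (d ≡ᵇ k)))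
    where
    by-raises : ∀ i → hasDes (+ k) (insertᵛ i (extreme m s) w)
                      ≡ (if raises i then 𝟙 (suc d ≡ᵇ k) else 𝟙 (d ≡ᵇ k))
    by-raises i rewrite ⌊+≟+⌋ (des (insertᵛ i (extreme m s) w)) k | des-insert i with raises i
    ... | true  = refl
    ... | false = refl

  t+f≡1+m : t + f ≡ suc m
  t+f≡1+m = ∑<-𝟙+𝟙-not (suc m) raises

  t+d≡m+𝟙s : t + d ≡ m + 𝟙 s
  t+d≡m+𝟙s = subst (λ n → (∑[ i < suc n ] 𝟙 (raises i)) + d ≡ n + 𝟙 s) (length-toList w)
    (∑<-raisesDes (+ 0) (toList w))

  d≤m : d ≤ m
  d≤m = subst (d ≤_) (length-toList w) (desFrom≤length (+ 0) (toList w))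

insertions-of-max : ∀ m w → all (boundedᵇ m) (toList w) ≡ true → ∀ k →
  ∑[ i < suc m ] hasDes (+ k) (insertᵛ i (extreme m false) w)
    ≡ (k + 1) * hasDes (+ k) w + (suc m ∸ k) * hasDes (+ k - + 1) w
insertions-of-max m w w-bounded k = begin
  ∑[ i < suc m ] hasDes (+ k) (insertᵛ i (extreme m false) w)
    ≡⟨ count-des k ⟩
  t * 𝟙 (suc d ≡ᵇ k) + f * 𝟙 (d ≡ᵇ k)
    ≡⟨ cong₂ (λ a b → a * 𝟙 (suc d ≡ᵇ k) + b * 𝟙 (d ≡ᵇ k)) t≡m∸d f≡d+1 ⟩
  (m ∸ d) * 𝟙 (suc d ≡ᵇ k) + (d + 1) * 𝟙 (d ≡ᵇ k)
    ≡⟨ cong₂ _+_ (𝟙≡ᵇ-subst (suc d) k (suc m ∸_)) (𝟙≡ᵇ-subst d k (_+ 1)) ⟩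
  (suc m ∸ k) * 𝟙 (suc d ≡ᵇ k) + (k + 1) * 𝟙 (d ≡ᵇ k)
    ≡⟨ +-comm ((suc m ∸ k) * 𝟙 (suc d ≡ᵇ k)) _ ⟩
  (k + 1) * 𝟙 (d ≡ᵇ k) + (suc m ∸ k) * 𝟙 (suc d ≡ᵇ k)
    ≡⟨ sym (cong₂ (λ a b → (k + 1) * 𝟙 a + (suc m ∸ k) * 𝟙 b) (⌊+≟+⌋ d k) (⌊+≟+-1⌋ d k)) ⟩
  (k + 1) * hasDes (+ k) w + (suc m ∸ k) * hasDes (+ k - + 1) w ∎
  where
  open ≡-Reasoning
  open InsertionCounts m false w w-bounded
  t+d≡m : t + d ≡ m
  t+d≡m = trans t+d≡m+𝟙s (+-identityʳ m)
  t≡m∸d : t ≡ m ∸ d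
  t≡m∸d = trans (sym (m+n∸n≡m t d)) (cong (_∸ d) t+d≡m)
  f≡d+1 : f ≡ d + 1
  f≡d+1 = +-cancelˡ-≡ t f (d + 1)
    (trans t+f≡1+m (trans (+-comm 1 m) (trans (cong (_+ 1) (sym t+d≡m)) (+-assoc t d 1))))

insertions-of-min : ∀ m w → all (boundedᵇ m) (toList w) ≡ true → ∀ k →
  ∑[ i < suc m ] hasDes (+ k) (insertᵛ i (extreme m true) w)
    ≡ k * hasDes (+ k) w + (suc m ∸ k + 1) * hasDes (+ k - + 1) w
insertions-of-min m w w-bounded k = begin
  ∑[ i < suc m ] hasDes (+ k) (insertᵛ i (extreme m true) w)
    ≡⟨ count-des k ⟩
  t * 𝟙 (suc d ≡ᵇ k) + f * 𝟙 (d ≡ᵇ k)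
    ≡⟨ cong₂ (λ a b → a * 𝟙 (suc d ≡ᵇ k) + b * 𝟙 (d ≡ᵇ k)) t≡m∸d+1 f≡d ⟩
  (m ∸ d + 1) * 𝟙 (suc d ≡ᵇ k) + d * 𝟙 (d ≡ᵇ k)
    ≡⟨ cong₂ _+_ (𝟙≡ᵇ-subst (suc d) k (λ x → suc m ∸ x + 1)) (𝟙≡ᵇ-subst d k (λ x → x)) ⟩
  (suc m ∸ k + 1) * 𝟙 (suc d ≡ᵇ k) + k * 𝟙 (d ≡ᵇ k)
    ≡⟨ +-comm ((suc m ∸ k + 1) * 𝟙 (suc d ≡ᵇ k)) _ ⟩
  k * 𝟙 (d ≡ᵇ k) + (suc m ∸ k + 1) * 𝟙 (suc d ≡ᵇ k)
    ≡⟨ sym (cong₂ (λ a b → k * 𝟙 a + (suc m ∸ k + 1) * 𝟙 b) (⌊+≟+⌋ d k) (⌊+≟+-1⌋ d k)) ⟩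
  k * hasDes (+ k) w + (suc m ∸ k + 1) * hasDes (+ k - + 1) w ∎
  where
  open ≡-Reasoning
  open InsertionCounts m true w w-bounded
  t≡m∸d+1 : t ≡ m ∸ d + 1
  t≡m∸d+1 = trans (sym (m+n∸n≡m t d)) (trans (cong (_∸ d) t+d≡m+𝟙s) (+-∸-comm 1 d≤m))
  f≡d : f ≡ d
  f≡d = +-cancelˡ-≡ t f d (trans t+f≡1+m (trans (+-comm 1 m) (sym t+d≡m+𝟙s)))

b≡∑ : ∀ n k (U : Subset n) → b n k U ≡ ∑[ v ∈ allVecs (range n) n ] 𝟙 (signedPermWith U v) * hasDes k v
b≡∑ n k U = begin
  length (filterᵇ P (filterᵇ (isSignedPerm n) vs))
    ≡⟨ length≡∑1 (filterᵇ P (filterᵇ (isSignedPerm n) vs)) ⟩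
  ∑[ v ∈ filterᵇ P (filterᵇ (isSignedPerm n) vs) ] 1
    ≡⟨ ∑-filterᵇ P (filterᵇ (isSignedPerm n) vs) (λ _ → 1) ⟩
  ∑[ v ∈ filterᵇ (isSignedPerm n) vs ] 𝟙 (P v) * 1
    ≡⟨ ∑-filterᵇ (isSignedPerm n) vs (λ v → 𝟙 (P v) * 1) ⟩
  ∑[ v ∈ vs ] 𝟙 (isSignedPerm n v) * (𝟙 (P v) * 1)
    ≡⟨ ∑-cong vs (λ v → 𝟙-∧ (isSignedPerm n v) ⌊ + des v ℤ.≟ k ⌋ (signCond U v)) ⟩
  ∑[ v ∈ vs ] 𝟙 (signedPermWith U v) * hasDes k v ∎
  where
  open ≡-Reasoning
  vs = allVecs (range n) n
  P = λ (σ : Vec ℤ n) → ⌊ + des σ ℤ.≟ k ⌋ ∧ signCond U σ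
  𝟙-∧ : ∀ a d c → 𝟙 a * (𝟙 (d ∧ c) * 1) ≡ 𝟙 (a ∧ c) * 𝟙 d
  𝟙-∧ true  true  true  = refl
  𝟙-∧ true  true  false = refl
  𝟙-∧ true  false true  = refl
  𝟙-∧ true  false false = refl
  𝟙-∧ false d     c     = refl

b≡∑-insertions : ∀ m k (U : Subset (suc m)) →
  b (suc m) (+ k) U ≡ ∑[ w ∈ allVecs (range m) m ] 𝟙 (signedPermWith (init U) w)
                        * (∑[ i < suc m ] hasDes (+ k) (insertᵛ i (extreme m (last U)) w))
b≡∑-insertions m k U = begin
  b (suc m) (+ k) U
    ≡⟨ b≡∑ (suc m) (+ k) U ⟩
  ∑[ v ∈ allVecs R (suc m) ] χ v * E v
    ≡⟨ ∑-cong (allVecs R (suc m)) one-occurrence ⟩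
  ∑[ v ∈ allVecs R (suc m) ] occurrences v * (χ v * E v)
    ≡⟨ ∑-occurrences m (λ v → χ v * E v) ⟩
  ∑[ i < suc m ] ∑[ w ∈ V ] χ (insertᵛ i e w) * E (insertᵛ i e w)
    ≡⟨ ∑<-cong (suc m) (λ i → ∑-cong V (λ w →
         cong (λ z → 𝟙 z * E (insertᵛ i e w)) (signedPermWith-insert m U i w))) ⟩
  ∑[ i < suc m ] ∑[ w ∈ V ] χ′ w * E (insertᵛ i e w)
    ≡⟨ sym (∑-∑<-comm V (suc m) (λ w i → χ′ w * E (insertᵛ i e w))) ⟩
  ∑[ w ∈ V ] ∑[ i < suc m ] χ′ w * E (insertᵛ i e w)
    ≡⟨ ∑-cong V (λ w → ∑<-*ˡ (suc m) (χ′ w) (λ i → E (insertᵛ i e w))) ⟩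
  ∑[ w ∈ V ] χ′ w * (∑[ i < suc m ] E (insertᵛ i e w))
    ≡⟨ ∑-allVecs-range-suc m m _ unbounded-vanishes ⟩
  ∑[ w ∈ allVecs (range m) m ] χ′ w * (∑[ i < suc m ] E (insertᵛ i e w)) ∎
  where
  open ≡-Reasoning
  R = range (suc m)
  V = allVecs R m
  e = extreme m (last U)
  E : ∀ {n} → Vec ℤ n → ℕ
  E = hasDes (+ k)
  χ : Vec ℤ (suc m) → ℕ
  χ v = 𝟙 (signedPermWith U v)
  χ′ : Vec ℤ m → ℕ
  χ′ w = 𝟙 (signedPermWith (init U) w)
  open RemoveMarked R e (λ x → ⌊ x ℤ.≟ e ⌋) (extreme-unique m (last U))
  one-occurrence : ∀ v → χ v * E v ≡ occurrences v * (χ v * E v)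
  one-occurrence v with signedPermWith U v in sp
  ... | true  rewrite count-extreme≡1 m U v sp = sym (*-identityˡ _)
  ... | false = sym (*-zeroʳ (occurrences v))
  unbounded-vanishes : ∀ w → all (boundedᵇ m) (toList w) ≡ false → χ′ w * (∑[ i < suc m ] E (insertᵛ i e w)) ≡ 0
  unbounded-vanishes w unbounded with signedPermWith (init U) w in sp
  ... | false = refl
  ... | true with trans (sym (signedPermWith⇒bounded (init U) w sp)) unbounded
  ...   | ()

b-recursion : ∀ m k (U : Subset (suc m)) s c₁ c₂ → last U ≡ s →
  (∀ w → all (boundedᵇ m) (toList w) ≡ true →
     ∑[ i < suc m ] hasDes (+ k) (insertᵛ i (extreme m s) w)
       ≡ c₁ * hasDes (+ k) w + c₂ * hasDes (+ k - + 1) w) →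
  b (suc m) (+ k) U ≡ c₁ * b m (+ k) (init U) + c₂ * b m (+ k - + 1) (init U)
b-recursion m k U _ c₁ c₂ refl insertions = begin
  b (suc m) (+ k) U
    ≡⟨ b≡∑-insertions m k U ⟩
  ∑[ w ∈ W ] χ w * inserted w
    ≡⟨ ∑-cong W split ⟩
  ∑[ w ∈ W ] (c₁ * (χ w * hasDes (+ k) w) + c₂ * (χ w * hasDes (+ k - + 1) w))
    ≡⟨ ∑-+ W _ _ ⟩
  (∑[ w ∈ W ] c₁ * (χ w * hasDes (+ k) w)) + (∑[ w ∈ W ] c₂ * (χ w * hasDes (+ k - + 1) w))
    ≡⟨ cong₂ _+_ (trans (∑-*ˡ W c₁ _) (cong (c₁ *_) (sym (b≡∑ m (+ k) U′))))
                 (trans (∑-*ˡ W c₂ _) (cong (c₂ *_) (sym (b≡∑ m (+ k - + 1) U′)))) ⟩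
  c₁ * b m (+ k) U′ + c₂ * b m (+ k - + 1) U′ ∎
  where
  open ≡-Reasoning
  W = allVecs (range m) m
  U′ = init U
  χ inserted : Vec ℤ m → ℕ
  χ w = 𝟙 (signedPermWith U′ w)
  inserted w = ∑[ i < suc m ] hasDes (+ k) (insertᵛ i (extreme m (last U)) w)
  split : ∀ w → χ w * inserted w ≡ c₁ * (χ w * hasDes (+ k) w) + c₂ * (χ w * hasDes (+ k - + 1) w)
  split w with signedPermWith U′ w in sp
  ... | false = sym (cong₂ _+_ (*-zeroʳ c₁) (*-zeroʳ c₂))
  ... | true  = trans (*-identityˡ _) (trans (insertions w (signedPermWith⇒bounded U′ w sp))
                  (sym (cong₂ _+_ (cong (c₁ *_) (*-identityˡ _)) (cong (c₂ *_) (*-identityˡ _)))))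

proposition4p2 : (m k : ℕ) (U : Subset (suc m)) → k ≤ suc m →
    (last U ≡ false →
    b (suc m) (+ k) U ≡ (k + 1) * b m (+ k) (init U) + (suc m ∸ k) * b m (+ k - + 1) (init U))
    × (last U ≡ true →
    b (suc m) (+ k) U ≡ k * b m (+ k) (init U) + (suc m ∸ k + 1) * b m (+ k - + 1) (init U))
proposition4p2 m k U _ =
    (λ n∉U → b-recursion m k U false (k + 1) (suc m ∸ k) n∉U
               (λ w w-bounded → insertions-of-max m w w-bounded k))
  , (λ n∈U → b-recursion m k U true k (suc m ∸ k + 1) n∈U
               (λ w w-bounded → insertions-of-min m w w-bounded k))
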